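{- Let $H$ be an oriented graph on $h$ vertices and let $K(H)$ be as defined in the context. Consider any labeling of the vertices of $H$ by $1,\dots,h$ and let $G$ be the corresponding backedge graph. Then for every order-preserving homomorphism $f : G \rightarrow K(H)$ there is a set $X \subseteq V(H)$ such that $f|_{X}$ is a graph isomorphism from $G[X]$ onto $K(H)$.
   Context: Undirected graphs here have vertex sets that are subsets of $\mathbb{N}$. An order-preserving homomorphism from $G$ to $G'$ is a map $f:V(G)\to V(G')$ with $i\le j\Rightarrow f(i)\le f(j)$ and $\{i,j\}\in E(G)\Rightarrow\{f(i),f(j)\}\in E(G')$; an order-preserving isomorphism is one that is a graph isomorphism, and $G\cong G'$ means such an isomorphism exists. Subgraphs inherit vertex labels. The ordered core of $G$ is a subgraph of $G$ with the fewest vertices among subgraphs to which $G$ has an order-preserving homomorphism. Given a labeling of the vertices of an oriented graph $H$ by distinct natural numbers, its backedge graph is the undirected graph on the labels in which $\{i,j\}$, $i<j$, is an edge iff $j\to i$ in $H$. Let $\mathcal{C}(H)$ be the set of ordered cores of the backedge graphs of $H$ over all $h!$ labelings of $V(H)$ by $1,\dots,h$. $K(H)$ is a fixed maximal element of $\mathcal{C}(H)$, meaning: $K(H)\in\mathcal{C}(H)$ and for every $C\in\mathcal{C}(H)$, if there is an order-preserving homomorphism from $C$ to $K(H)$ then $C\cong K(H)$. -}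

module Defs where

open import Data.Bool using (Bool; true; false; T; _∧_; if_then_else_)
open import Data.Nat using (ℕ; _<ᵇ_)
import Data.Nat as ℕ
open import Data.Fin using (Fin; toℕ)
import Data.Fin as F
open import Data.Fin.Permutation using (Permutation′; _⟨$⟩ʳ_)
open import Data.List using (List; length; filterᵇ; allFin)
open import Data.Product using (Σ; ∃; _×_; _,_)
open import Relation.Nullary using (¬_)
open import Relation.Binary.PropositionalEquality using (_≡_)

-- Convention: every graph in this statement has its vertex set inside
-- {1,…,h}.  The label ℓ ∈ {1,…,h} is represented by the index i : Fin h
-- with ℓ = toℕ i + 1; this is order-preserving, so the order on labels is
-- the order F._≤_ on Fin h.

record OrientedGraph (h : ℕ) : Set where
  field
    arc     : Fin h → Fin h → Bool
    irrefl  : ∀ u → ¬ T (arc u u)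
    antisym : ∀ u v → T (arc u v) → ¬ T (arc v u)
open OrientedGraph public

record Graph (h : ℕ) : Set where
  field
    V : Fin h → Bool
    E : Fin h → Fin h → Bool
open Graph public

record IsGraph {h : ℕ} (G : Graph h) : Set where
  field
    edge-sym    : ∀ i j → T (E G i j) → T (E G j i)
    edge-irrefl : ∀ i → ¬ T (E G i i)
    edge-in-V   : ∀ i j → T (E G i j) → T (V G i) × T (V G j)

size : ∀ {h} → Graph h → ℕ
size {h} G = length (filterᵇ (V G) (allFin h))

record Subgraph {h : ℕ} (C G : Graph h) : Set where
  field
    isGraph : IsGraph C
    V⊆      : ∀ i → T (V C i) → T (V G i)
    E⊆      : ∀ i j → T (E C i j) → T (E G i j)

-- Order-preserving homomorphism G → G' (only the values of f on V(G) matter).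
record IsOPHom {h : ℕ} (G G' : Graph h) (f : Fin h → Fin h) : Set where
  field
    maps-V  : ∀ i → T (V G i) → T (V G' (f i))
    mono    : ∀ i j → T (V G i) → T (V G j) → i F.≤ j → f i F.≤ f j
    pres-E  : ∀ i j → T (E G i j) → T (E G' (f i) (f j))

record IsOPIso {h : ℕ} (G G' : Graph h) (f : Fin h → Fin h) : Set where
  field
    hom     : IsOPHom G G' f
    inj     : ∀ i j → T (V G i) → T (V G j) → f i ≡ f j → i ≡ j
    surj    : ∀ k → T (V G' k) → ∃ λ i → T (V G i) × f i ≡ k
    refl-E  : ∀ i j → T (V G i) → T (V G j) → T (E G' (f i) (f j)) → T (E G i j)

HasOPHom : ∀ {h} → Graph h → Graph h → Set
HasOPHom G G' = ∃ λ f → IsOPHom G G' f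

_≅_ : ∀ {h} → Graph h → Graph h → Set
G ≅ G' = ∃ λ f → IsOPIso G G' f

record IsOrderedCore {h : ℕ} (G C : Graph h) : Set where
  field
    sub     : Subgraph C G
    hom     : HasOPHom G C
    minimal : ∀ C' → Subgraph C' G → HasOPHom G C' → size C ℕ.≤ size C'

-- Backedge graph of H for the labeling in which the vertex τ ℓ of H gets
-- label ℓ (τ ranges over all h! bijections {labels} → V(H)):
-- {i,j} with i < j is an edge iff  τ j → τ i  in H.
backedge : ∀ {h} → OrientedGraph h → Permutation′ h → Graph h
backedge H τ = record
  { V = λ _ → true
  ; E = λ i j → if toℕ i <ᵇ toℕ j then arc H (τ ⟨$⟩ʳ j) (τ ⟨$⟩ʳ i)
                else if toℕ j <ᵇ toℕ i then arc H (τ ⟨$⟩ʳ i) (τ ⟨$⟩ʳ j)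
                else false
  }

InCores : ∀ {h} → OrientedGraph h → Graph h → Set
InCores H C = ∃ λ τ → IsOrderedCore (backedge H τ) C

record IsMaximalCore {h : ℕ} (H : OrientedGraph h) (K : Graph h) : Set where
  field
    inCores : InCores H K
    maximal : ∀ C → InCores H C → HasOPHom C K → C ≅ K

induced : ∀ {h} → Graph h → (Fin h → Bool) → Graph h
induced G X = record
  { V = λ i → V G i ∧ X i
  ; E = λ i j → E G i j ∧ X i ∧ X j
  }

-- Let G be the backedge graph.  The image X of an order-preserving endomorphism
-- of G with the fewest image vertices spans an ordered core G[X] of G, and f
-- restricts to a homomorphism G[X] → K, so maximality of K yields an isomorphism
-- φ : G[X] ≅ K.  Now f ∘ φ⁻¹ is an order-preserving endomorphism of K, and K is
-- itself an ordered core; by minimality every such endomorphism is onto V(K),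
-- and an order-preserving surjection of a finite chain onto itself is the
-- identity.  Hence f = φ on X.

module Submission where

open import Defs
open import Data.Bool using (Bool; true; false; T; _∧_)
open import Data.Bool.Properties using (T-∧; T?)
open import Data.Nat using (ℕ; zero; suc; z≤n; _<ᵇ_)
import Data.Nat as ℕ
import Data.Nat.Properties as ℕ
open import Data.Fin using (Fin; toℕ; _≤_; _<_)
open import Data.Fin.Properties using (any?; all?; _≟_; _≤?_; _<?_; ≤-total; ≤-antisym; ≤-reflexive)
open import Data.Fin.Induction using (<-wellFounded; >-wellFounded)
open import Data.Fin.Permutation using (Permutation′)
open import Data.Vec.Functional using (_∷_; head; tail)
open import Data.List using (List; filterᵇ; allFin)
open import Data.List.Membership.Propositional using (_∈_)
open import Data.List.Membership.Propositional.Properties using (∈-allFin; ∈-filter⁺; ∈-filter⁻)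
open import Data.List.Relation.Binary.Pointwise using (Pointwise-≡⇒≡)
open import Data.List.Relation.Binary.Sublist.Propositional using (_⊆_; ⊆-refl)
import Data.List.Relation.Binary.Sublist.Propositional.Properties as Sublist
open import Data.Product using (∃; _×_; _,_; proj₁; proj₂)
open import Data.Sum using (inj₁; inj₂)
open import Function using (_∘_; id; Equivalence)
open import Induction.WellFounded using (WellFounded; Acc; acc)
open import Level using (0ℓ)
open import Relation.Binary using (Rel)
import Relation.Binary as B
open import Relation.Nullary using (¬_; Dec; yes; no; contradiction)
open import Relation.Nullary.Decidable using (⌊_⌋; toWitness; fromWitness; map′; _×-dec_; _→-dec_)
open import Relation.Unary using (Decidable)
open import Relation.Binary.PropositionalEquality using (_≡_; refl; sym; trans; cong; subst; subst₂; _≗_; module ≡-Reasoning)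

∧-intro : ∀ {a b} → T a → T b → T (a ∧ b)
∧-intro p q = Equivalence.from T-∧ (p , q)

∧-elim : ∀ {a b} → T (a ∧ b) → T a × T b
∧-elim = Equivalence.to T-∧

anyFunction? : ∀ {n m} {P : (Fin n → Fin m) → Set} →
  (∀ {f g} → f ≗ g → P f → P g) → Decidable P → Dec (∃ P)
anyFunction? {zero} P-resp P? = map′ (_ ,_) (λ (f , Pf) → P-resp (λ ()) Pf) (P? λ ())
anyFunction? {suc n} {m} P-resp P? = map′
  (λ (a , g , P[a∷g]) → a ∷ g , P[a∷g])
  (λ (f , Pf) → head f , tail f , P-resp head∷tail Pf)
  (any? λ a → anyFunction? (P-resp ∘ ∷-cong a) (P? ∘ (a ∷_)))
  where
  head∷tail : ∀ {f : Fin (suc n) → Fin m} → f ≗ head f ∷ tail f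
  head∷tail Fin.zero = refl
  head∷tail (Fin.suc i) = refl
  ∷-cong : ∀ a {f g : Fin n → Fin m} → f ≗ g → a ∷ f ≗ a ∷ g
  ∷-cong a f≗g Fin.zero = refl
  ∷-cong a f≗g (Fin.suc i) = f≗g i

minimise : ∀ {A : Set} {P : A → Set} (μ : A → ℕ) →
  (∀ n → Dec (∃ λ x → P x × μ x ℕ.≤ n)) → ∃ P → ∃ λ x → P x × (∀ y → P y → μ x ℕ.≤ μ y)
minimise {P = P} μ below? (x , Px) = descend (μ x) x Px ℕ.≤-refl
  where
  descend : ∀ n x → P x → μ x ℕ.≤ n → ∃ λ x → P x × (∀ y → P y → μ x ℕ.≤ μ y)
  descend zero x Px μx≤0 = x , Px , λ y _ → ℕ.≤-trans μx≤0 z≤n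
  descend (suc n) x Px μx≤1+n with below? n
  ... | yes (y , Py , μy≤n) = descend n y Py μy≤n
  ... | no ¬below = x , Px , λ y Py → ℕ.≤-trans μx≤1+n (ℕ.≰⇒> λ μy≤n → ¬below (y , Py , μy≤n))

monotone-onto⇒¬k≺ψk : ∀ {A : Set} {_≺_ : Rel A 0ℓ} → WellFounded _≺_ → B.Decidable _≺_ →
  ∀ {P : A → Set} {ψ : A → A} →
  (∀ {a b} → P a → P b → ¬ b ≺ a → ¬ ψ b ≺ ψ a) → (∀ {k} → P k → ∃ λ a → P a × ψ a ≡ k) →
  ∀ {k} → P k → ¬ k ≺ ψ k
monotone-onto⇒¬k≺ψk {_≺_ = _≺_} ≺-wf _≺?_ {P} {ψ} mono onto {k} = go (≺-wf k)
  where
  -- Take a with ψ a = k.  If a ≺ k, the induction hypothesis at a is violated;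
  -- otherwise monotonicity gives ¬ ψ a ≺ ψ k, i.e. ¬ k ≺ ψ k.
  go : ∀ {k} → Acc _≺_ k → P k → ¬ k ≺ ψ k
  go (acc smaller) Pk with onto Pk
  ... | a , Pa , refl with a ≺? ψ a
  ...   | yes a≺ψa = λ _ → go (smaller a≺ψa) Pa a≺ψa
  ...   | no  a⊀ψa = mono Pk Pa a⊀ψa

monotone-onto⇒fixes : ∀ {n} {P : Fin n → Set} {ψ : Fin n → Fin n} →
  (∀ {a b} → P a → P b → a ≤ b → ψ a ≤ ψ b) → (∀ {k} → P k → ∃ λ a → P a × ψ a ≡ k) →
  ∀ {k} → P k → ψ k ≡ k
monotone-onto⇒fixes {P = P} {ψ} mono onto Pk = ≤-antisym
  (ℕ.≮⇒≥ (monotone-onto⇒¬k≺ψk <-wellFounded _<?_ mono< onto Pk))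
  (ℕ.≮⇒≥ (monotone-onto⇒¬k≺ψk >-wellFounded (λ a b → b <? a) (λ Pa Pb → mono< Pb Pa) onto Pk))
  where
  mono< : ∀ {a b} → P a → P b → ¬ b < a → ¬ ψ b < ψ a
  mono< Pa Pb b≮a = ℕ.≤⇒≯ (mono Pa Pb (ℕ.≮⇒≥ b≮a))

open IsOPHom

private
  variable
    h : ℕ
    C F G G′ K : Graph h
    f g φ ψ : Fin h → Fin h

infix 4 _⊆ᵛ_
_⊆ᵛ_ : Graph h → Graph h → Set
G ⊆ᵛ G′ = ∀ i → T (V G i) → T (V G′ i)

vertices : Graph h → List (Fin h)
vertices {h} G = filterᵇ (V G) (allFin h)

vertices-⊆ : G ⊆ᵛ G′ → vertices G ⊆ vertices G′
vertices-⊆ {h} {G} {G′} G⊆G′ =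
  Sublist.filter⁺ (T? ∘ V G) (T? ∘ V G′) (λ { refl → G⊆G′ _ }) (⊆-refl {x = allFin h})

size-mono : G ⊆ᵛ G′ → size G ℕ.≤ size G′
size-mono {G = G} {G′} G⊆G′ =
  Sublist.length-mono-≤ {as = vertices G} {bs = vertices G′} (vertices-⊆ {G = G} {G′} G⊆G′)

size-≥⇒⊇ᵛ : G ⊆ᵛ G′ → size G′ ℕ.≤ size G → G′ ⊆ᵛ G
size-≥⇒⊇ᵛ {h} {G} {G′} G⊆G′ G′≤G i i∈G′ = proj₂ (∈-filter⁻ (T? ∘ V G) {xs = allFin h} i∈G-list)
  where
  same-vertices : vertices G ≡ vertices G′
  same-vertices = Pointwise-≡⇒≡ (Sublist.to-≋
    (ℕ.≤-antisym (size-mono {G = G} {G′} G⊆G′) G′≤G) (vertices-⊆ {G = G} {G′} G⊆G′))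
  i∈G-list : i ∈ vertices G
  i∈G-list = subst (i ∈_) (sym same-vertices) (∈-filter⁺ (T? ∘ V G′) (∈-allFin i) i∈G′)

induced-⊆ᵛ : ∀ G X → induced {h} G X ⊆ᵛ G
induced-⊆ᵛ G X i = proj₁ ∘ ∧-elim {V G i}

Subgraph-refl : IsGraph G → Subgraph G G
Subgraph-refl G-graph = record { isGraph = G-graph ; V⊆ = λ _ → id ; E⊆ = λ _ _ → id }

Subgraph-induced : Subgraph K G → ∀ X → Subgraph (induced K X) G
Subgraph-induced {K = K} K⊆G X = record
  { isGraph = record
    { edge-sym = λ i j ij∈K[X] →
        let (ij∈K , i∈X , j∈X) = split-edge ij∈K[X]
        in ∧-intro (edge-sym i j ij∈K) (∧-intro j∈X i∈X)
    ; edge-irrefl = λ i ii∈K[X] → edge-irrefl i (proj₁ (split-edge ii∈K[X]))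
    ; edge-in-V = λ i j ij∈K[X] →
        let (ij∈K , i∈X , j∈X) = split-edge ij∈K[X]
            (i∈K , j∈K) = edge-in-V i j ij∈K
        in ∧-intro i∈K i∈X , ∧-intro j∈K j∈X
    }
  ; V⊆ = λ i → V⊆ i ∘ proj₁ ∘ ∧-elim {V K i}
  ; E⊆ = λ i j → E⊆ i j ∘ proj₁ ∘ split-edge
  }
  where
  open Subgraph K⊆G
  open IsGraph isGraph
  split-edge : ∀ {i j} → T (E K i j ∧ X i ∧ X j) → T (E K i j) × T (X i) × T (X j)
  split-edge {i} {j} e = let (ij∈K , ij∈X) = ∧-elim {E K i j} e in ij∈K , ∧-elim {X i} ij∈X

backedge-isGraph : ∀ (H : OrientedGraph h) τ → IsGraph (backedge H τ)
backedge-isGraph H τ = record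
  { edge-sym = symmetric ; edge-irrefl = irreflexive ; edge-in-V = λ _ _ _ → _ , _ }
  where
  <ᵇ-true : ∀ m n → (m <ᵇ n) ≡ true → m ℕ.< n
  <ᵇ-true m n m<n = ℕ.<ᵇ⇒< m n (subst T (sym m<n) _)
  symmetric : ∀ i j → T (E (backedge H τ) i j) → T (E (backedge H τ) j i)
  symmetric i j ij∈G with toℕ i <ᵇ toℕ j in i<j | toℕ j <ᵇ toℕ i in j<i
  ... | true  | true  = contradiction (<ᵇ-true (toℕ j) (toℕ i) j<i) (ℕ.<-asym (<ᵇ-true (toℕ i) (toℕ j) i<j))
  ... | true  | false = ij∈G
  ... | false | _     = ij∈G
  irreflexive : ∀ i → ¬ T (E (backedge H τ) i i)
  irreflexive i ii∈G with toℕ i <ᵇ toℕ i in i<i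
  ... | true  = ℕ.<-irrefl refl (<ᵇ-true (toℕ i) (toℕ i) i<i)
  ... | false = ii∈G

IsOPHom-∘ : IsOPHom F G f → IsOPHom G K g → IsOPHom F K (g ∘ f)
IsOPHom-∘ {f = f} f-hom g-hom = record
  { maps-V = λ i → maps-V g-hom (f i) ∘ maps-V f-hom i
  ; mono = λ i j i∈F j∈F i≤j →
      mono g-hom _ _ (maps-V f-hom i i∈F) (maps-V f-hom j j∈F) (mono f-hom i j i∈F j∈F i≤j)
  ; pres-E = λ i j → pres-E g-hom (f i) (f j) ∘ pres-E f-hom i j
  }

IsOPHom-restrict : IsOPHom G K f → ∀ X → IsOPHom (induced G X) K f
IsOPHom-restrict {G = G} f-hom X = record
  { maps-V = λ i → maps-V f-hom i ∘ proj₁ ∘ ∧-elim {V G i}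
  ; mono = λ i j i∈G[X] j∈G[X] →
      mono f-hom i j (proj₁ (∧-elim {V G i} i∈G[X])) (proj₁ (∧-elim {V G j} j∈G[X]))
  ; pres-E = λ i j → pres-E f-hom i j ∘ proj₁ ∘ ∧-elim {E G i j}
  }

IsOPHom-into-supergraph : Subgraph K G′ → IsOPHom G K f → IsOPHom G G′ f
IsOPHom-into-supergraph K⊆G′ f-hom = record
  { maps-V = λ i → V⊆ _ ∘ maps-V f-hom i
  ; mono = mono f-hom
  ; pres-E = λ i j → E⊆ _ _ ∘ pres-E f-hom i j
  }
  where open Subgraph K⊆G′

IsOPHom-cong : IsGraph G → (∀ i → T (V G i) → f i ≡ g i) → IsOPHom G K f → IsOPHom G K g
IsOPHom-cong {G = G} {K = K} G-graph f≐g f-hom = record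
  { maps-V = λ i i∈G → subst (T ∘ V K) (f≐g i i∈G) (maps-V f-hom i i∈G)
  ; mono = λ i j i∈G j∈G → subst₂ _≤_ (f≐g i i∈G) (f≐g j j∈G) ∘ mono f-hom i j i∈G j∈G
  ; pres-E = λ i j ij∈G →
      let (i∈G , j∈G) = edge-in-V i j ij∈G
      in subst₂ (λ a b → T (E K a b)) (f≐g i i∈G) (f≐g j j∈G) (pres-E f-hom i j ij∈G)
  }
  where open IsGraph G-graph

IsOPIso-cong : IsGraph G → (∀ i → T (V G i) → f i ≡ g i) → IsOPIso G K f → IsOPIso G K g
IsOPIso-cong {G = G} {K = K} G-graph f≐g f-iso = record
  { hom = IsOPHom-cong G-graph f≐g hom
  ; inj = λ i j i∈G j∈G gi≡gj → inj i j i∈G j∈G (trans (f≐g i i∈G) (trans gi≡gj (sym (f≐g j j∈G))))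
  ; surj = λ k k∈K → let (i , i∈G , fi≡k) = surj k k∈K in i , i∈G , trans (sym (f≐g i i∈G)) fi≡k
  ; refl-E = λ i j i∈G j∈G →
      refl-E i j i∈G j∈G ∘ subst₂ (λ a b → T (E K a b)) (sym (f≐g i i∈G)) (sym (f≐g j j∈G))
  }
  where open IsOPIso f-iso

isOPHom? : ∀ (G K : Graph h) f → Dec (IsOPHom G K f)
isOPHom? G K f = map′
  (λ (V-ok , mono-ok , E-ok) → record { maps-V = V-ok ; mono = mono-ok ; pres-E = E-ok })
  (λ f-hom → maps-V f-hom , mono f-hom , pres-E f-hom)
  (  all? (λ i → T? (V G i) →-dec T? (V K (f i)))
  ×-dec all? (λ i → all? λ j → T? (V G i) →-dec T? (V G j) →-dec i ≤? j →-dec f i ≤? f j)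
  ×-dec all? (λ i → all? λ j → T? (E G i j) →-dec T? (E K (f i) (f j))))

IsOPIso⇒leftInverse : ∀ {h} {G G′ : Graph h} {φ} → IsGraph G′ → IsOPIso G G′ φ →
  ∃ λ φ⁻¹ → IsOPHom G′ G φ⁻¹ × (∀ i → T (V G i) → φ⁻¹ (φ i) ≡ i)
IsOPIso⇒leftInverse {h} {G} {G′} {φ} G′-graph φ-iso = φ⁻¹ , φ⁻¹-hom , φ⁻¹∘φ
  where
  open IsOPIso φ-iso
  φ⁻¹ : Fin h → Fin h
  φ⁻¹ k with T? (V G′ k)
  ... | yes k∈G′ = proj₁ (surj k k∈G′)
  ... | no  _    = k
  preimage : ∀ k → T (V G′ k) → T (V G (φ⁻¹ k)) × φ (φ⁻¹ k) ≡ k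
  preimage k k∈G′ with T? (V G′ k)
  ... | yes k∈G′ = proj₂ (surj k k∈G′)
  ... | no  k∉G′ = contradiction k∈G′ k∉G′
  φ⁻¹-mono : ∀ k k′ → T (V G′ k) → T (V G′ k′) → k ≤ k′ → φ⁻¹ k ≤ φ⁻¹ k′
  φ⁻¹-mono k k′ k∈G′ k′∈G′ k≤k′ with ≤-total (φ⁻¹ k) (φ⁻¹ k′)
  ... | inj₁ φ⁻¹k≤φ⁻¹k′ = φ⁻¹k≤φ⁻¹k′
  ... | inj₂ φ⁻¹k′≤φ⁻¹k =
    let (x∈G , φx≡k) = preimage k k∈G′
        (x′∈G , φx′≡k′) = preimage k′ k′∈G′
        k′≤k = subst₂ _≤_ φx′≡k′ φx≡k (mono hom _ _ x′∈G x∈G φ⁻¹k′≤φ⁻¹k)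
    in ≤-reflexive (cong φ⁻¹ (≤-antisym k≤k′ k′≤k))
  φ⁻¹-hom : IsOPHom G′ G φ⁻¹
  φ⁻¹-hom = record
    { maps-V = λ k → proj₁ ∘ preimage k
    ; mono = φ⁻¹-mono
    ; pres-E = λ k k′ kk′∈G′ →
        let (k∈G′ , k′∈G′) = IsGraph.edge-in-V G′-graph k k′ kk′∈G′
            (x∈G , φx≡k) = preimage k k∈G′
            (x′∈G , φx′≡k′) = preimage k′ k′∈G′
        in refl-E _ _ x∈G x′∈G (subst₂ (λ a b → T (E G′ a b)) (sym φx≡k) (sym φx′≡k′) kk′∈G′)
    }
  φ⁻¹∘φ : ∀ i → T (V G i) → φ⁻¹ (φ i) ≡ i
  φ⁻¹∘φ i i∈G = let (x∈G , φx≡φi) = preimage (φ i) (maps-V hom i i∈G) in inj _ i x∈G i∈G φx≡φi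

image : Graph h → (Fin h → Fin h) → Fin h → Bool
image G f k = ⌊ any? (λ a → T? (V G a) ×-dec f a ≟ k) ⌋

image-intro : ∀ G f {a k} → T (V {h} G a) → f a ≡ k → T (image G f k)
image-intro G f a∈G fa≡k = fromWitness (_ , a∈G , fa≡k)

image-elim : ∀ G f {k} → T (image {h} G f k) → ∃ λ a → T (V G a) × f a ≡ k
image-elim G f = toWitness

induced-image-⊆ᵛ : IsOPHom G K f → ∀ G′ → induced G′ (image G f) ⊆ᵛ K
induced-image-⊆ᵛ {G = G} {K = K} {f = f} f-hom G′ k k∈G′[fG] =
  let (a , a∈G , fa≡k) = image-elim G f (proj₂ (∧-elim {V G′ k} k∈G′[fG]))
  in subst (T ∘ V K) fa≡k (maps-V f-hom a a∈G)

IsOPHom-corestrict : IsGraph G → IsOPHom G K f → IsOPHom G (induced K (image G f)) f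
IsOPHom-corestrict {G = G} {f = f} G-graph f-hom = record
  { maps-V = λ i i∈G → ∧-intro (maps-V f-hom i i∈G) (image-intro G f i∈G refl)
  ; mono = mono f-hom
  ; pres-E = λ i j ij∈G →
      let (i∈G , j∈G) = IsGraph.edge-in-V G-graph i j ij∈G
      in ∧-intro (pres-E f-hom i j ij∈G) (∧-intro (image-intro G f i∈G refl) (image-intro G f j∈G refl))
  }

imageSize : Graph h → (Fin h → Fin h) → ℕ
imageSize G f = size (induced G (image G f))

≗⇒imageSize≤ : ∀ G → f ≗ g → imageSize G g ℕ.≤ imageSize G f
≗⇒imageSize≤ {f = f} {g = g} G f≗g =
  size-mono {G = induced G (image G g)} {G′ = induced G (image G f)} λ i i∈G[gG] →
    let (i∈G , i∈gG) = ∧-elim {V G i} i∈G[gG]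
        (a , a∈G , ga≡i) = image-elim G g i∈gG
    in ∧-intro i∈G (image-intro G f a∈G (trans (f≗g a) ga≡i))

minimalEndo-exists : IsGraph G →
  ∃ λ g → IsOPHom G G g × ∀ f → IsOPHom G G f → imageSize G g ℕ.≤ imageSize G f
minimalEndo-exists {G = G} G-graph = minimise (imageSize G) endo-below? (id , id-hom)
  where
  id-hom : IsOPHom G G id
  id-hom = record { maps-V = λ _ → id ; mono = λ _ _ _ _ → id ; pres-E = λ _ _ → id }
  endo-below? : ∀ n → Dec (∃ λ f → IsOPHom G G f × imageSize G f ℕ.≤ n)
  endo-below? n = anyFunction?
    (λ f≗g (f-hom , fG≤n) → IsOPHom-cong G-graph (λ i _ → f≗g i) f-hom , ℕ.≤-trans (≗⇒imageSize≤ G f≗g) fG≤n)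
    (λ f → isOPHom? G G f ×-dec imageSize G f ℕ.≤? n)

minimalEndo⇒orderedCore : IsGraph G → IsOPHom G G g →
  (∀ f → IsOPHom G G f → imageSize G g ℕ.≤ imageSize G f) → IsOrderedCore G (induced G (image G g))
minimalEndo⇒orderedCore {G = G} {g = g} G-graph g-hom g-minimal = record
  { sub = Subgraph-induced (Subgraph-refl G-graph) (image G g)
  ; hom = g , IsOPHom-corestrict G-graph g-hom
  ; minimal = λ C C⊆G (c , c-hom) → ℕ.≤-trans
      (g-minimal c (IsOPHom-into-supergraph C⊆G c-hom))
      (size-mono {G = induced G (image G c)} {G′ = C} (induced-image-⊆ᵛ c-hom G))
  }

orderedCore-exists : IsGraph G → ∃ λ X → IsOrderedCore G (induced G X)
orderedCore-exists {G = G} G-graph =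
  let (g , g-hom , g-minimal) = minimalEndo-exists G-graph
  in image G g , minimalEndo⇒orderedCore G-graph g-hom g-minimal

orderedCore-endo-onto : IsGraph G → IsOrderedCore G K → IsOPHom K K ψ →
  ∀ {k} → T (V K k) → ∃ λ a → T (V K a) × ψ a ≡ k
orderedCore-endo-onto {G = G} {K = K} {ψ = ψ} G-graph K-core ψ-hom {k} k∈K
  with IsOrderedCore.hom K-core
... | h₀ , h₀-hom =
  let (a , a∈G , ψh₀a≡k) = image-elim G (ψ ∘ h₀) (proj₂ (∧-elim {V K k} (K⊆K[S] k k∈K)))
  in h₀ a , maps-V h₀-hom a a∈G , ψh₀a≡k
  where
  open IsOrderedCore K-core using (sub; minimal)
  -- ψ ∘ h₀ maps G into the subgraph K[S] on its image, so minimality of K forces K[S] = K.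
  K⊆K[S] : K ⊆ᵛ induced K (image G (ψ ∘ h₀))
  K⊆K[S] = size-≥⇒⊇ᵛ {G = induced K _} {G′ = K} (induced-⊆ᵛ K _) (minimal _
    (Subgraph-induced sub _) (ψ ∘ h₀ , IsOPHom-corestrict G-graph (IsOPHom-∘ h₀-hom ψ-hom)))

orderedCore-rigid : IsGraph G → IsOrderedCore G K → IsOPHom K K ψ → ∀ k → T (V K k) → ψ k ≡ k
orderedCore-rigid {K = K} G-graph K-core ψ-hom k =
  monotone-onto⇒fixes {P = T ∘ V K} (mono ψ-hom _ _) (orderedCore-endo-onto G-graph K-core ψ-hom)

IsOPIso-into-orderedCore-unique : IsGraph G → IsOrderedCore G K → IsOPIso C K φ → IsOPHom C K f →
  ∀ i → T (V C i) → φ i ≡ f i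
IsOPIso-into-orderedCore-unique {φ = φ} {f = f} G-graph K-core φ-iso f-hom i i∈C =
  let (φ⁻¹ , φ⁻¹-hom , φ⁻¹∘φ) = IsOPIso⇒leftInverse (Subgraph.isGraph (IsOrderedCore.sub K-core)) φ-iso
      φi∈K = maps-V (IsOPIso.hom φ-iso) i i∈C
  in begin
    φ i           ≡⟨ orderedCore-rigid G-graph K-core (IsOPHom-∘ φ⁻¹-hom f-hom) (φ i) φi∈K ⟨
    f (φ⁻¹ (φ i)) ≡⟨ cong f (φ⁻¹∘φ i i∈C) ⟩
    f i           ∎
  where open ≡-Reasoning

proposition4p6 : ∀ {h : ℕ} (H : OrientedGraph h) (K : Graph h) → IsMaximalCore H K →
    (τ : Permutation′ h) (f : Fin h → Fin h) → IsOPHom (backedge H τ) K f →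
    ∃ λ (X : Fin h → Bool) → IsOPIso (induced (backedge H τ) X) K f
proposition4p6 H K K-maximal τ f f-hom =
  let (X , X-core) = orderedCore-exists (backedge-isGraph H τ)
      f-hom-X = IsOPHom-restrict f-hom X
      (φ , φ-iso) = IsMaximalCore.maximal K-maximal _ (τ , X-core) (f , f-hom-X)
      (τ₀ , K-core) = IsMaximalCore.inCores K-maximal
  in X , IsOPIso-cong (Subgraph.isGraph (IsOrderedCore.sub X-core))
           (IsOPIso-into-orderedCore-unique (backedge-isGraph H τ₀) K-core φ-iso f-hom-X) φ-iso
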